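{- Let $S$ and $T$ be two disjoint vertex sets in a graph $F$ such that any two vertices in $S$ have at least $s$ common neighbors in $T$. If there is an edge of $F$ with both endpoints in $S$, then, for any odd integer $l$ with $3 \leq l \leq \min(2s+1, 2|S|-1)$, the number of cycles of length $l$ in $F$ is at least $\left( s-l/2 +3/2\right)^{(l-1)/2} (|S| - (l-1)/2)^{(l-3)/2}$. -}

module Defs where

open import Data.Nat using (ℕ; zero; suc; _*_; _/_)
open import Data.Bool using (Bool; true; false; not; _∧_; _∨_)
open import Data.Fin using (Fin; _≟_)
open import Data.Fin.Subset using (Subset)
open import Data.List using (List; []; _∷_; map; concatMap; length; filterᵇ; allFin)
open import Data.Bool.ListAction using (any)
open import Data.Vec using (lookup)
open import Relation.Nullary.Decidable using (⌊_⌋)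
open import Relation.Binary.PropositionalEquality using (_≡_)

record Graph (n : ℕ) : Set where
  field
    adj       : Fin n → Fin n → Bool
    adj-sym   : ∀ u v → adj u v ≡ adj v u
    adj-irref : ∀ v → adj v v ≡ false
open Graph public

module _ {n : ℕ} where

  commonNbrsIn : Graph n → Subset n → Fin n → Fin n → ℕ
  commonNbrsIn G T u v =
    length (filterᵇ (λ t → lookup T t ∧ (adj G u t ∧ adj G v t)) (allFin n))

  allLists : ℕ → List (List (Fin n))
  allLists zero    = [] ∷ []
  allLists (suc l) = concatMap (λ x → map (x ∷_) (allLists l)) (allFin n)

  distinctᵇ : List (Fin n) → Bool
  distinctᵇ []       = true
  distinctᵇ (x ∷ xs) = not (any (λ y → ⌊ x ≟ y ⌋) xs) ∧ distinctᵇ xs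

  -- consecutive entries adjacent; second argument is the first vertex
  pathToᵇ : Graph n → Fin n → List (Fin n) → Bool
  pathToᵇ G v₀ []           = false
  pathToᵇ G v₀ (x ∷ [])     = adj G x v₀
  pathToᵇ G v₀ (x ∷ y ∷ xs) = adj G x y ∧ pathToᵇ G v₀ (y ∷ xs)

  closedCycleSeqᵇ : Graph n → List (Fin n) → Bool
  closedCycleSeqᵇ G []       = false
  closedCycleSeqᵇ G (x ∷ xs) = distinctᵇ (x ∷ xs) ∧ pathToᵇ G x (x ∷ xs)

  cycleSeqCount : Graph n → ℕ → ℕ
  cycleSeqCount G l = length (filterᵇ (closedCycleSeqᵇ G) (allLists l))

  -- number of cycles of length l (each cycle of length l ≥ 3 corresponds to
  -- exactly 2l such sequences: l starting points × 2 directions)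
  numCycles : Graph n → ℕ → ℕ
  numCycles G zero    = 0
  numCycles G (suc m) = cycleSeqCount G (suc m) / (2 * suc m)

-- Fix an edge uv inside S.  A sequence u v t₁ x₁ t₂ … x_{k−1} t_k of distinct vertices with
-- xᵢ ∈ S, tᵢ ∈ T, and each tᵢ a common neighbour of the S-vertices on either side of it
-- (x₀ = v, x_k = u) is a cycle of length l = 2k + 1.  Choosing the vertices one by one, every tᵢ
-- has at least s + 1 − k admissible values and every xᵢ at least |S| − k, so there are at least
-- (s + 1 − k)^k (|S| − k)^(k−1) such sequences, and as many again that start with the edge vu
-- and are then rotated to begin at u.  Rotating all of them so that u sits at position r, for
-- each r < l, gives l families of cycle sequences that are disjoint because the position of u
-- tells them apart.  So there are at least 2l times the bound cycle sequences, and each cycle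
-- accounts for exactly 2l of them.

module Submission where

open import Defs
open import Data.Bool using (Bool; true; false; not; _∧_; _∨_; if_then_else_)
open import Data.Bool.ListAction using (any)
open import Data.Bool.Properties using (∧-conicalˡ; ∧-conicalʳ; ∨-conicalˡ; ∨-conicalʳ; ∨-zeroʳ; not-injective)
open import Data.Empty using (⊥; ⊥-elim)
open import Data.Fin using (Fin; zero; suc; toℕ; _≟_)
open import Data.Fin.Properties using (suc-injective; toℕ-injective; toℕ<n)
open import Data.Fin.Subset using (Subset; ∣_∣; _∈_; _∉_)
open import Data.List using (List; []; _∷_; _++_; _∷ʳ_; [_]; take; drop; length; map; filterᵇ; tabulate; concatMap)
open import Data.List.Properties
  using (∷-injective; filter-++; length-++; ++-assoc; ++-identityʳ; ∷ʳ-++; take++drop≡id; length-take; length-drop)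
open import Data.Nat using (ℕ; zero; suc; _+_; _*_; _∸_; _^_; _≤_; _<_; _⊓_; z≤n; s≤s; _/_) renaming (_≟_ to _≟ℕ_)
open import Data.Nat.DivMod using (m*n/n≡m; /-monoˡ-≤)
open import Data.Nat.Properties hiding (_≟_; suc-injective)
open import Data.Nat.Tactic.RingSolver using (solve-∀)
open import Data.Product using (_×_; _,_; proj₁; proj₂; ∃)
open import Data.Sum using (_⊎_; inj₁; inj₂)
open import Data.Vec using (lookup) renaming ([] to []ᵛ; _∷_ to _∷ᵛ_)
open import Data.Vec.Properties using ([]=⇒lookup; lookup⇒[]=)
open import Function using (_∘_; case_of_)
open import Relation.Binary.PropositionalEquality
  using (_≡_; _≢_; refl; sym; trans; ≢-sym; cong; cong₂; subst; subst₂; module ≡-Reasoning)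
open import Relation.Nullary using (Dec; yes; no; ¬_)
open import Relation.Nullary.Decidable using (⌊_⌋; T?; dec-true; dec-false; isYes≗does)

open import Algebra.Properties.Semiring.Sum +-*-semiring
  using (sum; sum-syntax; sum-cong-≗; sum-replicate-zero; ∑-distrib-+; ∑-comm; *-distribˡ-sum; *-distribʳ-sum)
open import Algebra.Properties.CommutativeSemigroup *-commutativeSemigroup using (interchange)

𝟙 : Bool → ℕ
𝟙 true  = 1
𝟙 false = 0

𝟙-mono-≤ : ∀ {a b} → (a ≡ true → b ≡ true) → 𝟙 a ≤ 𝟙 b
𝟙-mono-≤ {false} a⇒b = z≤n
𝟙-mono-≤ {true}  a⇒b rewrite a⇒b refl = ≤-refl

𝟙-∧ : ∀ a b → 𝟙 (a ∧ b) ≡ 𝟙 a * 𝟙 b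
𝟙-∧ true  b = sym (+-identityʳ (𝟙 b))
𝟙-∧ false b = refl

𝟙-∨ : ∀ a b → 𝟙 (a ∨ b) ≤ 𝟙 a + 𝟙 b
𝟙-∨ true  b = s≤s z≤n
𝟙-∨ false b = ≤-refl

𝟙-∨-disjoint : ∀ a b → ¬ (a ≡ true × b ≡ true) → 𝟙 a + 𝟙 b ≤ 𝟙 (a ∨ b)
𝟙-∨-disjoint true  true  ¬both = ⊥-elim (¬both (refl , refl))
𝟙-∨-disjoint true  false ¬both = ≤-refl
𝟙-∨-disjoint false b     ¬both = ≤-refl

𝟙-∧-not : ∀ a b → 𝟙 a ≤ 𝟙 (a ∧ not b) + 𝟙 b
𝟙-∧-not true  true  = s≤s z≤n
𝟙-∧-not true  false = s≤s z≤n
𝟙-∧-not false b     = z≤n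

𝟙*-monoʳ-≤ : ∀ c {m n} → (c ≡ true → m ≤ n) → 𝟙 c * m ≤ 𝟙 c * n
𝟙*-monoʳ-≤ true  m≤n = *-monoʳ-≤ 1 (m≤n refl)
𝟙*-monoʳ-≤ false m≤n = z≤n

yes⇒⌊⌋ : ∀ {p} {P : Set p} (d : Dec P) → P → ⌊ d ⌋ ≡ true
yes⇒⌊⌋ d p = trans (isYes≗does d) (dec-true d p)

no⇒⌊⌋ : ∀ {p} {P : Set p} (d : Dec P) → ¬ P → ⌊ d ⌋ ≡ false
no⇒⌊⌋ d ¬p = trans (isYes≗does d) (dec-false d ¬p)

⌊⌋⇒yes : ∀ {p} {P : Set p} (d : Dec P) → ⌊ d ⌋ ≡ true → P
⌊⌋⇒yes (yes p) _ = p

sum-zero : ∀ {m} {f : Fin m → ℕ} → (∀ i → f i ≡ 0) → sum f ≡ 0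
sum-zero {m} f≡0 = trans (sum-cong-≗ f≡0) (sum-replicate-zero m)

sum-mono-≤ : ∀ {m} {f g : Fin m → ℕ} → (∀ i → f i ≤ g i) → sum f ≤ sum g
sum-mono-≤ {zero}  f≤g = z≤n
sum-mono-≤ {suc m} f≤g = +-mono-≤ (f≤g zero) (sum-mono-≤ (f≤g ∘ suc))

term≤sum : ∀ {m} (f : Fin m → ℕ) i → f i ≤ sum f
term≤sum f zero    = m≤m+n (f zero) _
term≤sum f (suc i) = ≤-trans (term≤sum (f ∘ suc) i) (m≤n+m _ (f zero))

*≤sum : ∀ {m x} (f : Fin m → ℕ) → (∀ i → x ≤ f i) → m * x ≤ sum f
*≤sum {zero}  f x≤f = z≤n
*≤sum {suc m} f x≤f = +-mono-≤ (x≤f zero) (*≤sum (f ∘ suc) (x≤f ∘ suc))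

sum-𝟙*-≤ : ∀ {m} (f : Fin m → Bool) {N} {g : Fin m → ℕ} → (∀ i → f i ≡ true → N ≤ g i) →
           (∑[ i < m ] 𝟙 (f i)) * N ≤ ∑[ i < m ] (𝟙 (f i) * g i)
sum-𝟙*-≤ f {N} N≤g = ≤-trans (≤-reflexive (*-distribʳ-sum N (𝟙 ∘ f))) (sum-mono-≤ λ i → 𝟙*-monoʳ-≤ (f i) (N≤g i))

sum-𝟙-exclusive : ∀ {m} c (f : Fin m → Bool) → (∀ i → f i ≡ true → c ≡ true) →
                  (∀ i j → f i ≡ true → f j ≡ true → i ≡ j) → ∑[ i < m ] 𝟙 (f i) ≤ 𝟙 c
sum-𝟙-exclusive {zero}  c f f⇒c unique = z≤n
sum-𝟙-exclusive {suc m} c f f⇒c unique with f zero in f₀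
... | true rewrite f⇒c zero f₀ = ≤-reflexive (cong suc (sum-zero rest≡0))
  where
  rest≡0 : ∀ i → 𝟙 (f (suc i)) ≡ 0
  rest≡0 i with f (suc i) in fᵢ
  ... | true  = case unique zero (suc i) f₀ fᵢ of λ ()
  ... | false = refl
... | false = sum-𝟙-exclusive c (f ∘ suc) (f⇒c ∘ suc) (λ i j fᵢ fⱼ → suc-injective (unique (suc i) (suc j) fᵢ fⱼ))

sum-𝟙-lookup : ∀ {m} (S : Subset m) → ∑[ x < m ] 𝟙 (lookup S x) ≡ ∣ S ∣
sum-𝟙-lookup []ᵛ          = refl
sum-𝟙-lookup (true ∷ᵛ S)  = cong suc (sum-𝟙-lookup S)
sum-𝟙-lookup (false ∷ᵛ S) = sum-𝟙-lookup S

module _ {a} {A : Set a} (P : A → Bool) where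

  length-filterᵇ-++ : ∀ xs ys → length (filterᵇ P (xs ++ ys)) ≡ length (filterᵇ P xs) + length (filterᵇ P ys)
  length-filterᵇ-++ xs ys = trans (cong length (filter-++ (T? ∘ P) xs ys)) (length-++ (filterᵇ P xs))

  length-filterᵇ-map : ∀ {b} {B : Set b} (f : B → A) xs → length (filterᵇ P (map f xs)) ≡ length (filterᵇ (P ∘ f) xs)
  length-filterᵇ-map f []       = refl
  length-filterᵇ-map f (x ∷ xs) with P (f x)
  ... | true  = cong suc (length-filterᵇ-map f xs)
  ... | false = length-filterᵇ-map f xs

  length-filterᵇ-tabulate : ∀ {m} (f : Fin m → A) → length (filterᵇ P (tabulate f)) ≡ ∑[ i < m ] 𝟙 (P (f i))
  length-filterᵇ-tabulate {zero}  f = refl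
  length-filterᵇ-tabulate {suc m} f with P (f zero)
  ... | true  = cong suc (length-filterᵇ-tabulate (f ∘ suc))
  ... | false = length-filterᵇ-tabulate (f ∘ suc)

  length-filterᵇ-concatMap : ∀ {m} {b} {B : Set b} (g : B → List A) (f : Fin m → B) →
    length (filterᵇ P (concatMap g (tabulate f))) ≡ ∑[ i < m ] length (filterᵇ P (g (f i)))
  length-filterᵇ-concatMap {zero}  g f = refl
  length-filterᵇ-concatMap {suc m} g f =
    trans (length-filterᵇ-++ (g (f zero)) _)
          (cong (length (filterᵇ P (g (f zero))) +_) (length-filterᵇ-concatMap g (f ∘ suc)))

module _ {a} {A : Set a} where

  rotate : List A → List A
  rotate []       = []
  rotate (x ∷ xs) = xs ∷ʳ x

  rotateBy : ℕ → List A → List A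
  rotateBy zero    w = w
  rotateBy (suc k) w = rotateBy k (rotate w)

  rotateBy-+ : ∀ j k w → rotateBy (j + k) w ≡ rotateBy k (rotateBy j w)
  rotateBy-+ zero    k w = refl
  rotateBy-+ (suc j) k w = rotateBy-+ j k (rotate w)

  rotateBy-++ : ∀ xs ys → rotateBy (length xs) (xs ++ ys) ≡ ys ++ xs
  rotateBy-++ []       ys = sym (++-identityʳ ys)
  rotateBy-++ (x ∷ xs) ys = begin
    rotateBy (length xs) ((xs ++ ys) ∷ʳ x) ≡⟨ cong (rotateBy (length xs)) (++-assoc xs ys [ x ]) ⟩
    rotateBy (length xs) (xs ++ ys ∷ʳ x)   ≡⟨ rotateBy-++ xs (ys ∷ʳ x) ⟩
    ys ∷ʳ x ++ xs                          ≡⟨ ∷ʳ-++ ys x xs ⟩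
    ys ++ x ∷ xs                           ∎
    where open ≡-Reasoning

  rotateBy-length : ∀ w → rotateBy (length w) w ≡ w
  rotateBy-length w = trans (cong (rotateBy (length w)) (sym (++-identityʳ w))) (rotateBy-++ w [])

  rotateBy-inverse : ∀ r w → r ≤ length w → rotateBy r (rotateBy (length w ∸ r) w) ≡ w
  rotateBy-inverse r w r≤∣w∣ = begin
    rotateBy r (rotateBy (length w ∸ r) w) ≡⟨ rotateBy-+ (length w ∸ r) r w ⟨
    rotateBy (length w ∸ r + r) w          ≡⟨ cong (λ k → rotateBy k w) (m∸n+n≡m r≤∣w∣) ⟩
    rotateBy (length w) w                  ≡⟨ rotateBy-length w ⟩
    w                                      ∎
    where open ≡-Reasoning

  rotate-rotateBy : ∀ L w → length w ≡ suc L → rotate (rotateBy L w) ≡ w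
  rotate-rotateBy L w ∣w∣ = begin
    rotate (rotateBy L w)  ≡⟨ rotateBy-+ L 1 w ⟨
    rotateBy (L + 1) w     ≡⟨ cong (λ k → rotateBy k w) (trans (+-comm L 1) (sym ∣w∣)) ⟩
    rotateBy (length w) w  ≡⟨ rotateBy-length w ⟩
    w                      ∎
    where open ≡-Reasoning

module _ {n : ℕ} where

  seqSum : ℕ → (List (Fin n) → ℕ) → ℕ
  seqSum zero    f = f []
  seqSum (suc l) f = ∑[ x < n ] seqSum l (λ w → f (x ∷ w))

  count : ℕ → (List (Fin n) → Bool) → ℕ
  count l P = seqSum l (𝟙 ∘ P)

  length-filterᵇ-allLists : ∀ l (P : List (Fin n) → Bool) → length (filterᵇ P (allLists l)) ≡ count l P
  length-filterᵇ-allLists zero    P with P []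
  ... | true  = refl
  ... | false = refl
  length-filterᵇ-allLists (suc l) P =
    trans (length-filterᵇ-concatMap P (λ x → map (x ∷_) (allLists l)) (λ x → x)) (sum-cong-≗ λ x →
      trans (length-filterᵇ-map P (x ∷_) (allLists l)) (length-filterᵇ-allLists l (λ w → P (x ∷ w))))

  seqSum-cong : ∀ l {f g : List (Fin n) → ℕ} → (∀ w → length w ≡ l → f w ≡ g w) → seqSum l f ≡ seqSum l g
  seqSum-cong zero    f≡g = f≡g [] refl
  seqSum-cong (suc l) f≡g = sum-cong-≗ λ x → seqSum-cong l λ w ∣w∣ → f≡g (x ∷ w) (cong suc ∣w∣)

  seqSum-mono-≤ : ∀ l {f g : List (Fin n) → ℕ} → (∀ w → length w ≡ l → f w ≤ g w) → seqSum l f ≤ seqSum l g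
  seqSum-mono-≤ zero    f≤g = f≤g [] refl
  seqSum-mono-≤ (suc l) f≤g = sum-mono-≤ λ x → seqSum-mono-≤ l λ w ∣w∣ → f≤g (x ∷ w) (cong suc ∣w∣)

  seqSum-distrib-+ : ∀ l (f g : List (Fin n) → ℕ) → seqSum l (λ w → f w + g w) ≡ seqSum l f + seqSum l g
  seqSum-distrib-+ zero    f g = refl
  seqSum-distrib-+ (suc l) f g = trans (sum-cong-≗ λ x → seqSum-distrib-+ l (f ∘ (x ∷_)) (g ∘ (x ∷_)))
                                       (∑-distrib-+ (λ x → seqSum l (f ∘ (x ∷_))) (λ x → seqSum l (g ∘ (x ∷_))))

  seqSum-distribˡ-* : ∀ l c (f : List (Fin n) → ℕ) → seqSum l (λ w → c * f w) ≡ c * seqSum l f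
  seqSum-distribˡ-* zero    c f = refl
  seqSum-distribˡ-* (suc l) c f = trans (sum-cong-≗ λ x → seqSum-distribˡ-* l c (f ∘ (x ∷_)))
                                        (sym (*-distribˡ-sum c λ x → seqSum l (f ∘ (x ∷_))))

  seqSum-∑ : ∀ l {m} (f : Fin m → List (Fin n) → ℕ) → seqSum l (λ w → ∑[ i < m ] f i w) ≡ ∑[ i < m ] seqSum l (f i)
  seqSum-∑ zero    f = refl
  seqSum-∑ (suc l) f = trans (sum-cong-≗ λ x → seqSum-∑ l (λ i w → f i (x ∷ w)))
                             (∑-comm λ x i → seqSum l (λ w → f i (x ∷ w)))

  seqSum-∷ʳ : ∀ l (f : List (Fin n) → ℕ) → seqSum (suc l) f ≡ ∑[ x < n ] seqSum l (λ w → f (w ∷ʳ x))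
  seqSum-∷ʳ zero    f = refl
  seqSum-∷ʳ (suc l) f = trans (sum-cong-≗ λ x → seqSum-∷ʳ l (λ w → f (x ∷ w)))
                              (∑-comm λ x y → seqSum l (λ w → f (x ∷ (w ∷ʳ y))))

  seqSum-rotate : ∀ l (f : List (Fin n) → ℕ) → seqSum l (f ∘ rotate) ≡ seqSum l f
  seqSum-rotate zero    f = refl
  seqSum-rotate (suc l) f = sym (seqSum-∷ʳ l f)

  seqSum-rotateBy : ∀ k l (f : List (Fin n) → ℕ) → seqSum l (f ∘ rotateBy k) ≡ seqSum l f
  seqSum-rotateBy zero    l f = refl
  seqSum-rotateBy (suc k) l f = trans (seqSum-rotate l (f ∘ rotateBy k)) (seqSum-rotateBy k l f)

  count-const-∧ : ∀ l c (P : List (Fin n) → Bool) → count l (λ w → c ∧ P w) ≡ 𝟙 c * count l P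
  count-const-∧ l c P = trans (seqSum-cong l λ w _ → 𝟙-∧ c (P w)) (seqSum-distribˡ-* l (𝟙 c) (𝟙 ∘ P))

module _ {n : ℕ} where

  infix 4.5 _∈ᵇ_
  _∈ᵇ_ : Fin n → List (Fin n) → Bool
  x ∈ᵇ []       = false
  x ∈ᵇ (y ∷ ys) = ⌊ x ≟ y ⌋ ∨ (x ∈ᵇ ys)

  ∈ᵇ-here : ∀ x xs → x ∈ᵇ x ∷ xs ≡ true
  ∈ᵇ-here x xs = cong (_∨ (x ∈ᵇ xs)) (yes⇒⌊⌋ (x ≟ x) refl)

  ∈ᵇ-there : ∀ x y xs → x ∈ᵇ xs ≡ true → x ∈ᵇ y ∷ xs ≡ true
  ∈ᵇ-there x y xs x∈xs = trans (cong (⌊ x ≟ y ⌋ ∨_) x∈xs) (∨-zeroʳ _)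

  ∈ᵇ-∷⁻ : ∀ x y xs → x ∈ᵇ y ∷ xs ≡ true → x ≡ y ⊎ x ∈ᵇ xs ≡ true
  ∈ᵇ-∷⁻ x y xs x∈ with x ≟ y
  ... | yes x≡y = inj₁ x≡y
  ... | no  _   = inj₂ x∈

  ∉ᵇ-∷ : ∀ {x y} xs → x ≢ y → x ∈ᵇ xs ≡ false → x ∈ᵇ y ∷ xs ≡ false
  ∉ᵇ-∷ {x} {y} xs x≢y x∉xs = cong₂ _∨_ (no⇒⌊⌋ (x ≟ y) x≢y) x∉xs

  ∉ᵇ-∷⁻ : ∀ x y xs → x ∈ᵇ y ∷ xs ≡ false → x ≢ y × x ∈ᵇ xs ≡ false
  ∉ᵇ-∷⁻ x y xs x∉ = (λ x≡y → case trans (sym (∨-conicalˡ _ _ x∉)) (yes⇒⌊⌋ (x ≟ y) x≡y) of λ ()) , ∨-conicalʳ _ _ x∉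

  ∈ᵇ∧∉ᵇ⇒≢ : ∀ {x y} xs → x ∈ᵇ xs ≡ true → y ∈ᵇ xs ≡ false → x ≢ y
  ∈ᵇ∧∉ᵇ⇒≢ xs x∈ y∉ refl = case trans (sym x∈) y∉ of λ ()

  ∉ᵇ-++ : ∀ x xs ys → x ∈ᵇ xs ≡ false → x ∈ᵇ ys ≡ false → x ∈ᵇ xs ++ ys ≡ false
  ∉ᵇ-++ x []       ys x∉xs x∉ys = x∉ys
  ∉ᵇ-++ x (y ∷ xs) ys x∉   x∉ys = ∉ᵇ-∷ (xs ++ ys) (proj₁ x∉y∷xs) (∉ᵇ-++ x xs ys (proj₂ x∉y∷xs) x∉ys)
    where x∉y∷xs = ∉ᵇ-∷⁻ x y xs x∉

  ∉ᵇ-++⁻ʳ : ∀ x xs ys → x ∈ᵇ xs ++ ys ≡ false → x ∈ᵇ ys ≡ false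
  ∉ᵇ-++⁻ʳ x []       ys x∉ = x∉
  ∉ᵇ-++⁻ʳ x (y ∷ xs) ys x∉ = ∉ᵇ-++⁻ʳ x xs ys (proj₂ (∉ᵇ-∷⁻ x y (xs ++ ys) x∉))

  sum-𝟙-∈ᵇ : ∀ U → ∑[ t < n ] 𝟙 (t ∈ᵇ U) ≤ length U
  sum-𝟙-∈ᵇ []      = ≤-reflexive (sum-zero {n} λ _ → refl)
  sum-𝟙-∈ᵇ (y ∷ U) = begin
    ∑[ t < n ] 𝟙 (⌊ t ≟ y ⌋ ∨ (t ∈ᵇ U))                   ≤⟨ sum-mono-≤ (λ t → 𝟙-∨ ⌊ t ≟ y ⌋ (t ∈ᵇ U)) ⟩
    ∑[ t < n ] (𝟙 ⌊ t ≟ y ⌋ + 𝟙 (t ∈ᵇ U))                ≡⟨ ∑-distrib-+ (λ t → 𝟙 ⌊ t ≟ y ⌋) (λ t → 𝟙 (t ∈ᵇ U)) ⟩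
    (∑[ t < n ] 𝟙 ⌊ t ≟ y ⌋) + (∑[ t < n ] 𝟙 (t ∈ᵇ U))   ≤⟨ +-mono-≤ at-most-y (sum-𝟙-∈ᵇ U) ⟩
    suc (length U)                                       ∎
    where
    open ≤-Reasoning
    at-most-y : ∑[ t < n ] 𝟙 ⌊ t ≟ y ⌋ ≤ 1
    at-most-y = sum-𝟙-exclusive true (λ t → ⌊ t ≟ y ⌋) (λ _ _ → refl)
                  (λ i j i≟y j≟y → trans (⌊⌋⇒yes (i ≟ y) i≟y) (sym (⌊⌋⇒yes (j ≟ y) j≟y)))

  sum-𝟙-∉ᵇ : ∀ (P : Fin n → Bool) U → (∑[ t < n ] 𝟙 (P t)) ∸ length U ≤ ∑[ t < n ] 𝟙 (P t ∧ not (t ∈ᵇ U))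
  sum-𝟙-∉ᵇ P U = begin
    (∑[ t < n ] 𝟙 (P t)) ∸ length U                ≤⟨ ∸-monoʳ-≤ _ (sum-𝟙-∈ᵇ U) ⟩
    (∑[ t < n ] 𝟙 (P t)) ∸ Σ∈                      ≤⟨ ∸-monoˡ-≤ Σ∈ split ⟩
    (∑[ t < n ] 𝟙 (P t ∧ not (t ∈ᵇ U))) + Σ∈ ∸ Σ∈  ≡⟨ m+n∸n≡m _ Σ∈ ⟩
    ∑[ t < n ] 𝟙 (P t ∧ not (t ∈ᵇ U))              ∎
    where
    open ≤-Reasoning
    Σ∈ = ∑[ t < n ] 𝟙 (t ∈ᵇ U)
    split : ∑[ t < n ] 𝟙 (P t) ≤ (∑[ t < n ] 𝟙 (P t ∧ not (t ∈ᵇ U))) + Σ∈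
    split = ≤-trans (sum-mono-≤ λ t → 𝟙-∧-not (P t) (t ∈ᵇ U))
                    (≤-reflexive (∑-distrib-+ (λ t → 𝟙 (P t ∧ not (t ∈ᵇ U))) (λ t → 𝟙 (t ∈ᵇ U))))

  any-≟≡∈ᵇ : ∀ x xs → any (λ y → ⌊ x ≟ y ⌋) xs ≡ x ∈ᵇ xs
  any-≟≡∈ᵇ x []       = refl
  any-≟≡∈ᵇ x (y ∷ xs) = cong (⌊ x ≟ y ⌋ ∨_) (any-≟≡∈ᵇ x xs)

  distinctᵇ-∷⁺ : ∀ x xs → x ∈ᵇ xs ≡ false → distinctᵇ xs ≡ true → distinctᵇ (x ∷ xs) ≡ true
  distinctᵇ-∷⁺ x xs x∉ dist = cong₂ _∧_ (cong not (trans (any-≟≡∈ᵇ x xs) x∉)) dist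

  distinctᵇ-∷⁻ : ∀ x xs → distinctᵇ (x ∷ xs) ≡ true → x ∈ᵇ xs ≡ false × distinctᵇ xs ≡ true
  distinctᵇ-∷⁻ x xs dist =
    trans (sym (any-≟≡∈ᵇ x xs)) (not-injective (∧-conicalˡ _ _ dist)) , ∧-conicalʳ (not (any (λ y → ⌊ x ≟ y ⌋) xs)) _ dist

  distinctᵇ-∷ʳ : ∀ xs x → x ∈ᵇ xs ≡ false → distinctᵇ xs ≡ true → distinctᵇ (xs ∷ʳ x) ≡ true
  distinctᵇ-∷ʳ []       x x∉ _    = refl
  distinctᵇ-∷ʳ (y ∷ xs) x x∉ dist =
    distinctᵇ-∷⁺ y (xs ∷ʳ x) (∉ᵇ-++ y xs [ x ] (proj₁ y∷xs) (∉ᵇ-∷ [] (≢-sym (proj₁ x∉y∷xs)) refl))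
                 (distinctᵇ-∷ʳ xs x (proj₂ x∉y∷xs) (proj₂ y∷xs))
    where
    y∷xs   = distinctᵇ-∷⁻ y xs dist
    x∉y∷xs = ∉ᵇ-∷⁻ x y xs x∉

  pathToᵇ-∷ʳ : ∀ (G : Graph n) {x y} w → pathToᵇ G x w ≡ true → adj G x y ≡ true → pathToᵇ G y (w ∷ʳ x) ≡ true
  pathToᵇ-∷ʳ G (z ∷ [])     path x~y = cong₂ _∧_ path x~y
  pathToᵇ-∷ʳ G (z ∷ z′ ∷ w) path x~y =
    cong₂ _∧_ (∧-conicalˡ _ _ path) (pathToᵇ-∷ʳ G (z′ ∷ w) (∧-conicalʳ (adj G z z′) _ path) x~y)

  closedCycleSeqᵇ-rotate : ∀ (G : Graph n) w → closedCycleSeqᵇ G w ≡ true → closedCycleSeqᵇ G (rotate w) ≡ true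
  closedCycleSeqᵇ-rotate G (x ∷ [])     closed = closed
  closedCycleSeqᵇ-rotate G (x ∷ y ∷ ys) closed =
    cong₂ _∧_ (distinctᵇ-∷ʳ (y ∷ ys) x (proj₁ x∷y∷ys) (proj₂ x∷y∷ys))
              (pathToᵇ-∷ʳ G (y ∷ ys) (∧-conicalʳ (adj G x y) _ path) (∧-conicalˡ _ _ path))
    where
    x∷y∷ys = distinctᵇ-∷⁻ x (y ∷ ys) (∧-conicalˡ _ _ closed)
    path   = ∧-conicalʳ (distinctᵇ (x ∷ y ∷ ys)) _ closed

  closedCycleSeqᵇ-rotateBy : ∀ (G : Graph n) k w → closedCycleSeqᵇ G w ≡ true → closedCycleSeqᵇ G (rotateBy k w) ≡ true
  closedCycleSeqᵇ-rotateBy G zero    w closed = closed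
  closedCycleSeqᵇ-rotateBy G (suc k) w closed = closedCycleSeqᵇ-rotateBy G k (rotate w) (closedCycleSeqᵇ-rotate G w closed)

  indexOf : Fin n → List (Fin n) → ℕ
  indexOf u []       = 0
  indexOf u (x ∷ xs) = if ⌊ x ≟ u ⌋ then 0 else suc (indexOf u xs)

  indexOf-++ : ∀ u ys zs → u ∈ᵇ ys ≡ false → indexOf u (ys ++ u ∷ zs) ≡ length ys
  indexOf-++ u []       zs u∉ys rewrite yes⇒⌊⌋ (u ≟ u) refl = refl
  indexOf-++ u (y ∷ ys) zs u∉ys rewrite no⇒⌊⌋ (y ≟ u) (≢-sym (proj₁ (∉ᵇ-∷⁻ u y ys u∉ys))) =
    cong suc (indexOf-++ u ys zs (proj₂ (∉ᵇ-∷⁻ u y ys u∉ys)))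

  indexOf-rotateBy : ∀ u c r → u ∈ᵇ c ≡ false → r ≤ length c →
                     indexOf u (rotateBy (suc (length c) ∸ r) (u ∷ c)) ≡ r
  indexOf-rotateBy u c r u∉c r≤∣c∣ = begin
    indexOf u (rotateBy (suc (length c) ∸ r) (u ∷ c))
      ≡⟨ cong₂ (λ k w → indexOf u (rotateBy k (u ∷ w))) (+-∸-assoc 1 r≤∣c∣) (sym (take++drop≡id m c)) ⟩
    indexOf u (rotateBy (suc m) (u ∷ zs ++ ys))
      ≡⟨ cong (λ k → indexOf u (rotateBy (suc k) (u ∷ zs ++ ys))) ∣zs∣≡m ⟨
    indexOf u (rotateBy (length (u ∷ zs)) (u ∷ zs ++ ys))
      ≡⟨ cong (indexOf u) (rotateBy-++ (u ∷ zs) ys) ⟩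
    indexOf u (ys ++ u ∷ zs)
      ≡⟨ indexOf-++ u ys zs (∉ᵇ-++⁻ʳ u zs ys (subst (λ w → u ∈ᵇ w ≡ false) (sym (take++drop≡id m c)) u∉c)) ⟩
    length ys
      ≡⟨ length-drop m c ⟩
    length c ∸ m
      ≡⟨ m∸[m∸n]≡n r≤∣c∣ ⟩
    r ∎
    where
    open ≡-Reasoning
    m  = length c ∸ r
    zs = take m c
    ys = drop m c
    ∣zs∣≡m : length zs ≡ m
    ∣zs∣≡m = trans (length-take m c) (m≤n⇒m⊓n≡m (m∸n≤m (length c) r))

module Anchoring {n} (G : Graph n) (u : Fin n) where

  anchoredAt : ℕ → (List (Fin n) → Bool) → List (Fin n) → Bool
  anchoredAt r B w = closedCycleSeqᵇ G w ∧ (⌊ indexOf u w ≟ℕ r ⌋ ∧ B (rotateBy r w))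

  StartsAtAnchor : ℕ → (List (Fin n) → Bool) → Set
  StartsAtAnchor l B = ∀ b → length b ≡ l → B b ≡ true → closedCycleSeqᵇ G b ≡ true × ∃ λ c → b ≡ u ∷ c

  anchoredAt-rotateBy : ∀ r c B → closedCycleSeqᵇ G (u ∷ c) ≡ true → B (u ∷ c) ≡ true → r ≤ length c →
                        anchoredAt r B (rotateBy (suc (length c) ∸ r) (u ∷ c)) ≡ true
  anchoredAt-rotateBy r c B closed Bb r≤∣c∣ = cong₂ _∧_
    (closedCycleSeqᵇ-rotateBy G (suc (length c) ∸ r) (u ∷ c) closed)
    (cong₂ _∧_ (yes⇒⌊⌋ (_ ≟ℕ r) (indexOf-rotateBy u c r u∉c r≤∣c∣))
               (subst (λ w → B w ≡ true) (sym (rotateBy-inverse r (u ∷ c) (m≤n⇒m≤1+n r≤∣c∣))) Bb))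
    where
    u∉c : u ∈ᵇ c ≡ false
    u∉c = proj₁ (distinctᵇ-∷⁻ u c (∧-conicalˡ _ _ closed))

  count-anchoredAt : ∀ l r B → r < l → StartsAtAnchor l B → count l B ≤ count l (anchoredAt r B)
  count-anchoredAt l r B r<l starts = begin
    count l B                                        ≤⟨ seqSum-mono-≤ l (λ b ∣b∣ → 𝟙-mono-≤ (rotated b ∣b∣)) ⟩
    seqSum l (𝟙 ∘ anchoredAt r B ∘ rotateBy (l ∸ r)) ≡⟨ seqSum-rotateBy (l ∸ r) l (𝟙 ∘ anchoredAt r B) ⟩
    count l (anchoredAt r B)                         ∎
    where
    open ≤-Reasoning
    rotated : ∀ b → length b ≡ l → B b ≡ true → anchoredAt r B (rotateBy (l ∸ r) b) ≡ true
    rotated b ∣b∣ Bb with starts b ∣b∣ Bb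
    ... | closed , c , refl = subst (λ k → anchoredAt r B (rotateBy (k ∸ r) (u ∷ c)) ≡ true) ∣b∣
      (anchoredAt-rotateBy r c B closed Bb (≤-pred (subst (r <_) (sym ∣b∣) r<l)))

  ∑-anchoredAt≤closed : ∀ l B w → ∑[ r < l ] 𝟙 (anchoredAt (toℕ r) B w) ≤ 𝟙 (closedCycleSeqᵇ G w)
  ∑-anchoredAt≤closed l B w = sum-𝟙-exclusive {l} (closedCycleSeqᵇ G w) (λ r → anchoredAt (toℕ r) B w)
    (λ r → ∧-conicalˡ _ _)
    (λ i j anchoredᵢ anchoredⱼ → toℕ-injective (trans (sym (position anchoredᵢ)) (position anchoredⱼ)))
    where
    position : ∀ {r} → anchoredAt r B w ≡ true → indexOf u w ≡ r
    position {r} anchored = ⌊⌋⇒yes (indexOf u w ≟ℕ r) (∧-conicalˡ _ _ (∧-conicalʳ (closedCycleSeqᵇ G w) _ anchored))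

  *-count≤count-closed : ∀ l B → StartsAtAnchor l B → l * count l B ≤ count l (closedCycleSeqᵇ G)
  *-count≤count-closed l B starts = begin
    l * count l B
      ≤⟨ *≤sum (λ r → count l (anchoredAt (toℕ r) B)) (λ r → count-anchoredAt l (toℕ r) B (toℕ<n r) starts) ⟩
    ∑[ r < l ] count l (anchoredAt (toℕ r) B)
      ≡⟨ seqSum-∑ l {l} (λ r → 𝟙 ∘ anchoredAt (toℕ r) B) ⟨
    seqSum l (λ w → ∑[ r < l ] 𝟙 (anchoredAt (toℕ r) B w))
      ≤⟨ seqSum-mono-≤ l (λ w _ → ∑-anchoredAt≤closed l B w) ⟩
    count l (closedCycleSeqᵇ G) ∎
    where open ≤-Reasoning

-- Alternating paths between S and T

altLength : ℕ → ℕ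
altLength zero    = 1
altLength (suc j) = suc (suc (altLength j))

altLength-odd : ∀ j → suc (suc (altLength j)) ≡ 2 * suc j + 1
altLength-odd zero    = refl
altLength-odd (suc j) = trans (cong (2 +_) (altLength-odd j)) (step j)
  where
  step : ∀ j → suc (suc (2 * suc j + 1)) ≡ 2 * suc (suc j) + 1
  step = solve-∀

module AlternatingPaths {n} (F : Graph n) (S T : Subset n) (s : ℕ)
  (disjoint : ∀ z → lookup S z ≡ true → lookup T z ≡ true → ⊥)
  (common : ∀ x y → lookup S x ≡ true → lookup S y ≡ true → x ≢ y →
            s ≤ ∑[ t < n ] 𝟙 (lookup T t ∧ (adj F x t ∧ adj F y t))) where

  separated : ∀ {x y} → lookup S x ≡ true → lookup T y ≡ true → x ≢ y
  separated {x} x∈S x∈T refl = disjoint x x∈S x∈T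

  freshT : Fin n → Fin n → List (Fin n) → Fin n → Bool
  freshT x y usedT t = (lookup T t ∧ (adj F x t ∧ adj F y t)) ∧ not (t ∈ᵇ usedT)

  freshS : List (Fin n) → Fin n → Bool
  freshS usedS x = lookup S x ∧ not (x ∈ᵇ usedS)

  freshT-∈T : ∀ {x y} usedT {t} → freshT x y usedT t ≡ true → lookup T t ≡ true
  freshT-∈T usedT ok = ∧-conicalˡ _ _ (∧-conicalˡ _ _ ok)

  freshT-adj : ∀ {x y} usedT {t} → freshT x y usedT t ≡ true → adj F x t ≡ true × adj F t y ≡ true
  freshT-adj {x} {y} usedT {t} ok = ∧-conicalˡ _ _ x~t∧y~t , trans (adj-sym F t y) (∧-conicalʳ (adj F x t) _ x~t∧y~t)
    where x~t∧y~t = ∧-conicalʳ (lookup T t) _ (∧-conicalˡ _ _ ok)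

  freshT-∉ : ∀ {x y} usedT {t} → freshT x y usedT t ≡ true → t ∈ᵇ usedT ≡ false
  freshT-∉ {x} {y} usedT {t} ok = not-injective (∧-conicalʳ (lookup T t ∧ (adj F x t ∧ adj F y t)) _ ok)

  freshS-∈S : ∀ usedS {x} → freshS usedS x ≡ true → lookup S x ≡ true
  freshS-∈S usedS ok = ∧-conicalˡ _ _ ok

  freshS-∉ : ∀ usedS {x} → freshS usedS x ≡ true → x ∈ᵇ usedS ≡ false
  freshS-∉ usedS {x} ok = not-injective (∧-conicalʳ (lookup S x) _ ok)

  -- altPathᵇ a x₀ usedS usedT (t₀ ∷ x₁ ∷ t₁ ∷ … ∷ xⱼ ∷ tⱼ ∷ []) continues a walk at x₀ through
  -- tᵢ ∈ T adjacent to xᵢ and xᵢ₊₁ (where x_{j+1} = a) and xᵢ ∈ S, every new vertex avoiding the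
  -- vertices usedS ⊆ S and usedT ⊆ T already on the walk.
  altPathᵇ : Fin n → Fin n → List (Fin n) → List (Fin n) → List (Fin n) → Bool
  altPathᵇ a prev usedS usedT []          = false
  altPathᵇ a prev usedS usedT (t ∷ [])    = freshT prev a usedT t
  altPathᵇ a prev usedS usedT (t ∷ x ∷ w) = (freshT prev x usedT t ∧ freshS usedS x) ∧ altPathᵇ a x (x ∷ usedS) (t ∷ usedT) w

  altPathᵇ-∷∷⁻ : ∀ a prev usedS usedT t x w → altPathᵇ a prev usedS usedT (t ∷ x ∷ w) ≡ true →
    freshT prev x usedT t ≡ true × freshS usedS x ≡ true × altPathᵇ a x (x ∷ usedS) (t ∷ usedT) w ≡ true
  altPathᵇ-∷∷⁻ a prev usedS usedT t x w ok =
    ∧-conicalˡ _ _ step , ∧-conicalʳ (freshT prev x usedT t) _ step , ∧-conicalʳ (freshT prev x usedT t ∧ freshS usedS x) _ ok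
    where step = ∧-conicalˡ _ _ ok

  count-freshT : ∀ {x y} usedT → lookup S x ≡ true → lookup S y ≡ true → x ≢ y →
                 s ∸ length usedT ≤ ∑[ t < n ] 𝟙 (freshT x y usedT t)
  count-freshT {x} {y} usedT x∈S y∈S x≢y =
    ≤-trans (∸-monoˡ-≤ (length usedT) (common x y x∈S y∈S x≢y))
            (sum-𝟙-∉ᵇ (λ t → lookup T t ∧ (adj F x t ∧ adj F y t)) usedT)

  count-freshS : ∀ usedS → ∣ S ∣ ∸ length usedS ≤ ∑[ x < n ] 𝟙 (freshS usedS x)
  count-freshS usedS =
    subst (λ k → k ∸ length usedS ≤ ∑[ x < n ] 𝟙 (freshS usedS x)) (sum-𝟙-lookup S) (sum-𝟙-∉ᵇ (lookup S) usedS)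

  count-steps : ∀ {prev} usedS usedT → lookup S prev ≡ true → prev ∈ᵇ usedS ≡ true →
                (∣ S ∣ ∸ length usedS) * (s ∸ length usedT) ≤ ∑[ t < n ] ∑[ x < n ] 𝟙 (freshT prev x usedT t ∧ freshS usedS x)
  count-steps {prev} usedS usedT prev∈S prev∈used = begin
    (∣ S ∣ ∸ length usedS) * (s ∸ length usedT)
      ≤⟨ *-monoˡ-≤ _ (count-freshS usedS) ⟩
    (∑[ x < n ] 𝟙 (freshS usedS x)) * (s ∸ length usedT)
      ≤⟨ sum-𝟙*-≤ (freshS usedS) (λ x fresh → count-freshT usedT prev∈S (freshS-∈S usedS fresh) (prev≢ x fresh)) ⟩
    ∑[ x < n ] (𝟙 (freshS usedS x) * ∑[ t < n ] 𝟙 (freshT prev x usedT t))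
      ≡⟨ sum-cong-≗ (λ x → *-distribˡ-sum (𝟙 (freshS usedS x)) (λ t → 𝟙 (freshT prev x usedT t))) ⟩
    ∑[ x < n ] ∑[ t < n ] (𝟙 (freshS usedS x) * 𝟙 (freshT prev x usedT t))
      ≡⟨ sum-cong-≗ (λ x → sum-cong-≗ λ t →
           trans (*-comm (𝟙 (freshS usedS x)) _) (sym (𝟙-∧ (freshT prev x usedT t) (freshS usedS x)))) ⟩
    ∑[ x < n ] ∑[ t < n ] 𝟙 (freshT prev x usedT t ∧ freshS usedS x)
      ≡⟨ ∑-comm (λ x t → 𝟙 (freshT prev x usedT t ∧ freshS usedS x)) ⟩
    ∑[ t < n ] ∑[ x < n ] 𝟙 (freshT prev x usedT t ∧ freshS usedS x) ∎
    where
    open ≤-Reasoning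
    prev≢ : ∀ x → freshS usedS x ≡ true → prev ≢ x
    prev≢ x fresh = ∈ᵇ∧∉ᵇ⇒≢ usedS prev∈used (freshS-∉ usedS fresh)

  -- A and B bound the numbers of choices for the last T-vertex and the last S-vertex of the path,
  -- which are made after j earlier choices from T and j − 1 earlier choices from S.
  count-altPathᵇ : ∀ j {A B} a prev usedS usedT →
    lookup S a ≡ true → lookup S prev ≡ true → prev ≢ a → prev ∈ᵇ usedS ≡ true → a ∈ᵇ usedS ≡ true →
    A ≤ s ∸ (length usedT + j) → B ≤ ∣ S ∣ ∸ (length usedS + j ∸ 1) →
    A ^ suc j * B ^ j ≤ count (altLength j) (altPathᵇ a prev usedS usedT)
  count-altPathᵇ zero {A} {B} a prev usedS usedT a∈S prev∈S prev≢a _ _ A≤ _ = begin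
    A * 1 * 1                             ≡⟨ trans (*-identityʳ (A * 1)) (*-identityʳ A) ⟩
    A                                     ≤⟨ A≤ ⟩
    s ∸ (length usedT + 0)                ≡⟨ cong (s ∸_) (+-identityʳ (length usedT)) ⟩
    s ∸ length usedT                      ≤⟨ count-freshT usedT prev∈S a∈S prev≢a ⟩
    count 1 (altPathᵇ a prev usedS usedT) ∎
    where open ≤-Reasoning
  count-altPathᵇ (suc j) {A} {B} a prev usedS usedT a∈S prev∈S prev≢a prev∈used a∈used A≤ B≤ = begin
    A ^ suc (suc j) * B ^ suc j
      ≡⟨ interchange A (A ^ suc j) B (B ^ j) ⟩
    A * B * N
      ≤⟨ *-monoˡ-≤ N (*-mono-≤ (≤-trans A≤ (∸-monoʳ-≤ s (m≤m+n q (suc j)))) (≤-trans B≤′ (∸-monoʳ-≤ ∣ S ∣ (m≤m+n p j)))) ⟩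
    (s ∸ q) * (∣ S ∣ ∸ p) * N
      ≤⟨ *-monoˡ-≤ N (≤-trans (≤-reflexive (*-comm (s ∸ q) _)) (count-steps usedS usedT prev∈S prev∈used)) ⟩
    (∑[ t < n ] ∑[ x < n ] 𝟙 (step t x)) * N
      ≡⟨ *-distribʳ-sum N (λ t → ∑[ x < n ] 𝟙 (step t x)) ⟩
    ∑[ t < n ] ((∑[ x < n ] 𝟙 (step t x)) * N)
      ≤⟨ sum-mono-≤ (λ t → sum-𝟙*-≤ (step t) (extend t)) ⟩
    ∑[ t < n ] ∑[ x < n ] (𝟙 (step t x) * count (altLength j) (altPathᵇ a x (x ∷ usedS) (t ∷ usedT)))
      ≡⟨ sum-cong-≗ (λ t → sum-cong-≗ λ x → count-const-∧ (altLength j) (step t x) _) ⟨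
    count (altLength (suc j)) (altPathᵇ a prev usedS usedT) ∎
    where
    open ≤-Reasoning
    p = length usedS
    q = length usedT
    N = A ^ suc j * B ^ j
    step : Fin n → Fin n → Bool
    step t x = freshT prev x usedT t ∧ freshS usedS x
    B≤′ : B ≤ ∣ S ∣ ∸ (p + j)
    B≤′ = subst (λ k → B ≤ ∣ S ∣ ∸ (k ∸ 1)) (+-suc p j) B≤
    extend : ∀ t x → step t x ≡ true → N ≤ count (altLength j) (altPathᵇ a x (x ∷ usedS) (t ∷ usedT))
    extend t x ok =
      count-altPathᵇ j a x (x ∷ usedS) (t ∷ usedT) a∈S (freshS-∈S usedS fresh) x≢a
        (∈ᵇ-here x usedS) (∈ᵇ-there a x usedS a∈used)
        (subst (λ k → A ≤ s ∸ k) (+-suc q j) A≤) B≤′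
      where
      fresh = ∧-conicalʳ (freshT prev x usedT t) _ ok
      x≢a : x ≢ a
      x≢a = ≢-sym (∈ᵇ∧∉ᵇ⇒≢ usedS a∈used (freshS-∉ usedS fresh))

  AllIn : Subset n → List (Fin n) → Set
  AllIn P U = ∀ z → z ∈ᵇ U ≡ true → lookup P z ≡ true

  AllIn-∷ : ∀ P {y} U → lookup P y ≡ true → AllIn P U → AllIn P (y ∷ U)
  AllIn-∷ P {y} U y∈P U⊆P z z∈ with ∈ᵇ-∷⁻ z y U z∈
  ... | inj₁ refl = y∈P
  ... | inj₂ z∈U  = U⊆P z z∈U

  Avoids : List (Fin n) → List (Fin n) → Set
  Avoids U w = ∀ z → z ∈ᵇ U ≡ true → z ∈ᵇ w ≡ false

  altPathᵇ-walk : ∀ a prev usedS usedT w → altPathᵇ a prev usedS usedT w ≡ true → pathToᵇ F a (prev ∷ w) ≡ true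
  altPathᵇ-walk a prev usedS usedT (t ∷ [])    ok = cong₂ _∧_ (proj₁ (freshT-adj usedT ok)) (proj₂ (freshT-adj usedT ok))
  altPathᵇ-walk a prev usedS usedT (t ∷ x ∷ w) ok with altPathᵇ-∷∷⁻ a prev usedS usedT t x w ok
  ... | tOk , _ , rest =
    cong₂ _∧_ (proj₁ (freshT-adj usedT tOk))
              (cong₂ _∧_ (proj₂ (freshT-adj usedT tOk)) (altPathᵇ-walk a x (x ∷ usedS) (t ∷ usedT) w rest))

  altPathᵇ-fresh : ∀ a prev usedS usedT w → altPathᵇ a prev usedS usedT w ≡ true → AllIn S usedS → AllIn T usedT →
                   distinctᵇ w ≡ true × Avoids usedS w × Avoids usedT w
  altPathᵇ-fresh a prev usedS usedT (t ∷ []) ok usedS⊆S _ =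
    refl ,
    (λ z z∈ → ∉ᵇ-∷ [] (separated (usedS⊆S z z∈) (freshT-∈T usedT ok)) refl) ,
    (λ z z∈ → ∉ᵇ-∷ [] (∈ᵇ∧∉ᵇ⇒≢ usedT z∈ (freshT-∉ usedT ok)) refl)
  altPathᵇ-fresh a prev usedS usedT (t ∷ x ∷ w) ok usedS⊆S usedT⊆T with altPathᵇ-∷∷⁻ a prev usedS usedT t x w ok
  ... | tOk , xOk , rest
    with altPathᵇ-fresh a x (x ∷ usedS) (t ∷ usedT) w rest
           (AllIn-∷ S usedS (freshS-∈S usedS xOk) usedS⊆S) (AllIn-∷ T usedT (freshT-∈T usedT tOk) usedT⊆T)
  ... | distinct , avoidsS , avoidsT =
    distinctᵇ-∷⁺ t (x ∷ w) (∉ᵇ-∷ w (≢-sym (separated x∈S t∈T)) (avoidsT t (∈ᵇ-here t usedT)))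
                 (distinctᵇ-∷⁺ x w (avoidsS x (∈ᵇ-here x usedS)) distinct) ,
    (λ z z∈ → ∉ᵇ-∷ (x ∷ w) (separated (usedS⊆S z z∈) t∈T)
                (∉ᵇ-∷ w (∈ᵇ∧∉ᵇ⇒≢ usedS z∈ (freshS-∉ usedS xOk)) (avoidsS z (∈ᵇ-there z x usedS z∈)))) ,
    (λ z z∈ → ∉ᵇ-∷ (x ∷ w) (∈ᵇ∧∉ᵇ⇒≢ usedT z∈ (freshT-∉ usedT tOk))
                (∉ᵇ-∷ w (≢-sym (separated x∈S (usedT⊆T z z∈))) (avoidsT z (∈ᵇ-there z t usedT z∈))))
    where
    t∈T = freshT-∈T usedT tOk
    x∈S = freshS-∈S usedS xOk

  altPathᵇ-head : ∀ a prev usedS usedT t w → altPathᵇ a prev usedS usedT (t ∷ w) ≡ true → lookup T t ≡ true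
  altPathᵇ-head a prev usedS usedT t []      ok = freshT-∈T usedT ok
  altPathᵇ-head a prev usedS usedT t (x ∷ w) ok = freshT-∈T usedT (proj₁ (altPathᵇ-∷∷⁻ a prev usedS usedT t x w ok))

  throughEdgeᵇ : Fin n → Fin n → List (Fin n) → Bool
  throughEdgeᵇ a b (a′ ∷ b′ ∷ w) = (⌊ a′ ≟ a ⌋ ∧ ⌊ b′ ≟ b ⌋) ∧ altPathᵇ a b (b ∷ a ∷ []) [] w
  throughEdgeᵇ a b _             = false

  count-throughEdgeᵇ : ∀ j {a b} → lookup S a ≡ true → lookup S b ≡ true → adj F a b ≡ true →
    (s ∸ j) ^ suc j * (∣ S ∣ ∸ suc j) ^ j ≤ count (suc (suc (altLength j))) (throughEdgeᵇ a b)
  count-throughEdgeᵇ j {a} {b} a∈S b∈S a~b = begin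
    (s ∸ j) ^ suc j * (∣ S ∣ ∸ suc j) ^ j
      ≤⟨ count-altPathᵇ j a b (b ∷ a ∷ []) [] a∈S b∈S b≢a
           (∈ᵇ-here b (a ∷ [])) (∈ᵇ-there a b (a ∷ []) (∈ᵇ-here a [])) ≤-refl ≤-refl ⟩
    count L (altPathᵇ a b (b ∷ a ∷ []) [])
      ≡⟨ seqSum-cong L (λ w _ → cong (λ c → 𝟙 (c ∧ altPathᵇ a b (b ∷ a ∷ []) [] w)) a≟a∧b≟b) ⟨
    count L (λ w → throughEdgeᵇ a b (a ∷ b ∷ w))
      ≤⟨ term≤sum (λ x → count L (λ w → throughEdgeᵇ a b (a ∷ x ∷ w))) b ⟩
    count (suc L) (λ w → throughEdgeᵇ a b (a ∷ w))
      ≤⟨ term≤sum (λ x → count (suc L) (λ w → throughEdgeᵇ a b (x ∷ w))) a ⟩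
    count (suc (suc L)) (throughEdgeᵇ a b) ∎
    where
    open ≤-Reasoning
    L = altLength j
    b≢a : b ≢ a
    b≢a refl = case trans (sym a~b) (adj-irref F a) of λ ()
    a≟a∧b≟b : ⌊ a ≟ a ⌋ ∧ ⌊ b ≟ b ⌋ ≡ true
    a≟a∧b≟b = cong₂ _∧_ (yes⇒⌊⌋ (a ≟ a) refl) (yes⇒⌊⌋ (b ≟ b) refl)

  throughEdgeᵇ-shape : ∀ a b w → throughEdgeᵇ a b w ≡ true →
    ∃ λ t → ∃ λ rest → w ≡ a ∷ b ∷ t ∷ rest × altPathᵇ a b (b ∷ a ∷ []) [] (t ∷ rest) ≡ true
  throughEdgeᵇ-shape a b (a′ ∷ b′ ∷ [])       ok = case ∧-conicalʳ (⌊ a′ ≟ a ⌋ ∧ ⌊ b′ ≟ b ⌋) _ ok of λ ()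
  throughEdgeᵇ-shape a b (a′ ∷ b′ ∷ t ∷ rest) ok
    with ⌊⌋⇒yes (a′ ≟ a) (∧-conicalˡ _ _ (∧-conicalˡ _ _ ok)) | ⌊⌋⇒yes (b′ ≟ b) (∧-conicalʳ ⌊ a′ ≟ a ⌋ _ (∧-conicalˡ _ _ ok))
  ... | refl | refl = t , rest , refl , ∧-conicalʳ (⌊ a′ ≟ a ⌋ ∧ ⌊ b′ ≟ b ⌋) _ ok

  throughEdgeᵇ-closed : ∀ {a b} w → lookup S a ≡ true → lookup S b ≡ true → adj F a b ≡ true →
                        throughEdgeᵇ a b w ≡ true → closedCycleSeqᵇ F w ≡ true
  throughEdgeᵇ-closed {a} {b} w a∈S b∈S a~b ok with throughEdgeᵇ-shape a b w ok
  ... | t , rest , refl , path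
    with altPathᵇ-fresh a b (b ∷ a ∷ []) [] (t ∷ rest) path (AllIn-∷ S (a ∷ []) b∈S (AllIn-∷ S [] a∈S (λ _ ()))) (λ _ ())
  ...   | distinct , avoidsS , _ = cong₂ _∧_
    (distinctᵇ-∷⁺ a (b ∷ t ∷ rest) (∉ᵇ-∷ (t ∷ rest) a≢b (avoidsS a (∈ᵇ-there a b (a ∷ []) (∈ᵇ-here a []))))
                  (distinctᵇ-∷⁺ b (t ∷ rest) (avoidsS b (∈ᵇ-here b (a ∷ []))) distinct))
    (cong₂ _∧_ a~b (altPathᵇ-walk a b (b ∷ a ∷ []) [] (t ∷ rest) path))
    where
    a≢b : a ≢ b
    a≢b refl = case trans (sym a~b) (adj-irref F a) of λ ()

-- Counting cycles through an edge

module CyclesThroughEdge {n} (F : Graph n) (S T : Subset n) (s : ℕ)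
  (disjoint : ∀ z → lookup S z ≡ true → lookup T z ≡ true → ⊥)
  (common : ∀ x y → lookup S x ≡ true → lookup S y ≡ true → x ≢ y →
            s ≤ ∑[ t < n ] 𝟙 (lookup T t ∧ (adj F x t ∧ adj F y t)))
  {u v : Fin n} (u∈S : lookup S u ≡ true) (v∈S : lookup S v ≡ true) (u~v : adj F u v ≡ true) (j : ℕ) where

  open AlternatingPaths F S T s disjoint common
  open Anchoring F u

  L : ℕ
  L = suc (altLength j)

  bound : ℕ
  bound = (s ∸ j) ^ suc j * (∣ S ∣ ∸ suc j) ^ j

  v~u : adj F v u ≡ true
  v~u = trans (adj-sym F v u) u~v

  -- On sequences of length suc L, rotateBy L rotates one step backwards, so the backward
  -- sequences are the u … v ones.
  forward backward : List (Fin n) → Bool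
  forward    = throughEdgeᵇ u v
  backward w = throughEdgeᵇ v u (rotateBy L w)

  backward-shape : ∀ w → length w ≡ suc L → backward w ≡ true →
    closedCycleSeqᵇ F w ≡ true × ∃ λ t → ∃ λ rest → w ≡ u ∷ t ∷ rest ∷ʳ v × lookup T t ≡ true
  backward-shape w ∣w∣ ok with throughEdgeᵇ-shape v u (rotateBy L w) ok
  ... | t , rest , w′≡ , path =
    subst (λ x → closedCycleSeqᵇ F x ≡ true) w≡
          (closedCycleSeqᵇ-rotate F (rotateBy L w) (throughEdgeᵇ-closed (rotateBy L w) v∈S u∈S v~u ok)) ,
    t , rest , trans (sym w≡) (cong rotate w′≡) , altPathᵇ-head v u (u ∷ v ∷ []) [] t rest path
    where
    w≡ : rotate (rotateBy L w) ≡ w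
    w≡ = rotate-rotateBy L w ∣w∣

  forward∨backward-startsAtAnchor : StartsAtAnchor (suc L) (λ w → forward w ∨ backward w)
  forward∨backward-startsAtAnchor w ∣w∣ ok with forward w in fw
  ... | true  with throughEdgeᵇ-shape u v w fw
  ...   | t , rest , refl , _ = throughEdgeᵇ-closed w u∈S v∈S u~v fw , v ∷ t ∷ rest , refl
  forward∨backward-startsAtAnchor w ∣w∣ ok | false with backward-shape w ∣w∣ ok
  ...   | closed , t , rest , refl , _ = closed , t ∷ rest ∷ʳ v , refl

  forward-backward-disjoint : ∀ w → length w ≡ suc L → ¬ (forward w ≡ true × backward w ≡ true)
  forward-backward-disjoint w ∣w∣ (fw , bw) with throughEdgeᵇ-shape u v w fw | backward-shape w ∣w∣ bw
  ... | _ , _ , refl , _ | _ , t , _ , w≡ , t∈T = separated v∈S t∈T (proj₁ (∷-injective (proj₂ (∷-injective w≡))))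

  count-forward∨backward : bound + bound ≤ count (suc L) (λ w → forward w ∨ backward w)
  count-forward∨backward = begin
    bound + bound
      ≤⟨ +-mono-≤ (count-throughEdgeᵇ j u∈S v∈S u~v) (count-throughEdgeᵇ j v∈S u∈S v~u) ⟩
    count (suc L) forward + count (suc L) (throughEdgeᵇ v u)
      ≡⟨ cong (count (suc L) forward +_) (seqSum-rotateBy L (suc L) (𝟙 ∘ throughEdgeᵇ v u)) ⟨
    count (suc L) forward + count (suc L) backward
      ≡⟨ seqSum-distrib-+ (suc L) (𝟙 ∘ forward) (𝟙 ∘ backward) ⟨
    seqSum (suc L) (λ w → 𝟙 (forward w) + 𝟙 (backward w))
      ≤⟨ seqSum-mono-≤ (suc L) (λ w ∣w∣ → 𝟙-∨-disjoint (forward w) (backward w) (forward-backward-disjoint w ∣w∣)) ⟩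
    count (suc L) (λ w → forward w ∨ backward w) ∎
    where open ≤-Reasoning

  bound*2l≤cycleSeqCount : bound * (2 * suc L) ≤ cycleSeqCount F (suc L)
  bound*2l≤cycleSeqCount = begin
    bound * (2 * suc L)                                  ≡⟨ double bound (suc L) ⟩
    suc L * (bound + bound)                              ≤⟨ *-monoʳ-≤ (suc L) count-forward∨backward ⟩
    suc L * count (suc L) (λ w → forward w ∨ backward w) ≤⟨ *-count≤count-closed (suc L) _ forward∨backward-startsAtAnchor ⟩
    count (suc L) (closedCycleSeqᵇ F)                    ≡⟨ length-filterᵇ-allLists (suc L) (closedCycleSeqᵇ F) ⟨
    cycleSeqCount F (suc L)                              ∎
    where
    open ≤-Reasoning
    double : ∀ B l → B * (2 * l) ≡ l * (B + B)
    double = solve-∀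

  bound≤numCycles : bound ≤ numCycles F (suc L)
  bound≤numCycles = begin
    bound                              ≡⟨ m*n/n≡m bound (2 * suc L) ⟨
    bound * (2 * suc L) / (2 * suc L)  ≤⟨ /-monoˡ-≤ (2 * suc L) bound*2l≤cycleSeqCount ⟩
    numCycles F (suc L)                ∎
    where open ≤-Reasoning

claim2p9 : (n : ℕ) (F : Graph n) (S T : Subset n) (s : ℕ)
    → (∀ v → v ∈ S → v ∉ T)
    → (∀ u v → u ∈ S → v ∈ S → ¬ (u ≡ v) → s ≤ commonNbrsIn F T u v)
    → (∃ λ u → ∃ λ v → u ∈ S × v ∈ S × adj F u v ≡ true)
    → (l k : ℕ) → l ≡ 2 * k + 1
    → 3 ≤ l → l ≤ (2 * s + 1) ⊓ (2 * ∣ S ∣ ∸ 1)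
    → (s + 1 ∸ k) ^ k * (∣ S ∣ ∸ k) ^ (k ∸ 1) ≤ numCycles F l
claim2p9 n F S T s _ _ _ l zero refl (s≤s ()) _
claim2p9 n F S T s disjoint common (u , v , u∈S , v∈S , u~v) l (suc j) l≡2k+1 _ _ =
  subst₂ (λ a m → a ^ suc j * (∣ S ∣ ∸ suc j) ^ j ≤ numCycles F m)
         (cong (_∸ suc j) (+-comm 1 s)) (trans (altLength-odd j) (sym l≡2k+1))
         (CyclesThroughEdge.bound≤numCycles F S T s disjointᵇ commonᵇ ([]=⇒lookup u∈S) ([]=⇒lookup v∈S) u~v j)
  where
  disjointᵇ : ∀ z → lookup S z ≡ true → lookup T z ≡ true → ⊥
  disjointᵇ z z∈S z∈T = disjoint z (lookup⇒[]= z S z∈S) (lookup⇒[]= z T z∈T)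
  commonᵇ : ∀ x y → lookup S x ≡ true → lookup S y ≡ true → x ≢ y → s ≤ ∑[ t < n ] 𝟙 (lookup T t ∧ (adj F x t ∧ adj F y t))
  commonᵇ x y x∈S y∈S x≢y =
    subst (s ≤_) (length-filterᵇ-tabulate (λ t → lookup T t ∧ (adj F x t ∧ adj F y t)) (λ t → t))
          (common x y (lookup⇒[]= x S x∈S) (lookup⇒[]= y S y∈S) x≢y)
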